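{- Let $m$ be an odd positive integer and $d \geq 2$ an integer. Then $\beta_{2m}(d) \geq 2\,\beta_{\{2,4,\ldots,2m\}}(d-1)$. Moreover, if $b$ is an even integer with $m < b \leq \beta_{\{2,4,\ldots,2m\}}(d-1)$, then $\beta_{2b-2m}(d) \geq 2b$.
   Context: For a set $W$ of positive integers containing at least one even number, $\beta_W(d)$ denotes the largest size of a set $A \subseteq \mathbb{Z}_2^d$ (of distinct elements) which has no subset $B \subseteq A$ with $|B| \in W$ and $\sum_{x\in B} x = 0$. For a positive integer $k$, $\beta_{2k}(d) = \beta_{\{2k\}}(d)$. -}

module Defs where

open import Data.Nat using (ℕ; _+_; _*_; _≤_; _<_)
open import Data.Bool using (Bool; false; _xor_)
open import Data.Vec using (Vec; replicate; zipWith)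
open import Data.List using (List; length; foldr)
open import Data.List.Relation.Unary.Unique.Propositional using (Unique)
open import Data.List.Relation.Binary.Sublist.Propositional using (_⊆_)
open import Data.Product using (Σ; _×_; ∃-syntax)
open import Relation.Binary.PropositionalEquality using (_≡_; _≢_)

Even : ℕ → Set
Even n = ∃[ k ] n ≡ 2 * k

Odd : ℕ → Set
Odd n = ∃[ k ] n ≡ 1 + 2 * k

Z2^ : ℕ → Set
Z2^ d = Vec Bool d

zeroV : ∀ {d} → Z2^ d
zeroV = replicate _ false

_⊕_ : ∀ {d} → Z2^ d → Z2^ d → Z2^ d
_⊕_ = zipWith _xor_

vsum : ∀ {d} → List (Z2^ d) → Z2^ d
vsum = foldr _⊕_ zeroV

-- A set A ⊆ Z_2^d of distinct elements (a duplicate-free list) is W-free if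
-- no subset B ⊆ A (a sublist of A, hence a set of distinct elements of A)
-- with |B| ∈ W has zero sum.
WFree : (W : ℕ → Set) {d : ℕ} → List (Z2^ d) → Set
WFree W A = (B : List _) → B ⊆ A → W (length B) → vsum B ≢ zeroV

Admissible : (W : ℕ → Set) (d : ℕ) → List (Z2^ d) → Set
Admissible W d A = Unique A × WFree W A

IsBeta : (W : ℕ → Set) (d : ℕ) → ℕ → Set
IsBeta W d n =
  (Σ (List (Z2^ d)) λ A → Admissible W d A × length A ≡ n)
  × ((A : List (Z2^ d)) → Admissible W d A → length A ≤ n)

Single : ℕ → ℕ → Set
Single k s = s ≡ 2 * k

EvensUpTo : ℕ → ℕ → Set
EvensUpTo m s = ∃[ j ] (1 ≤ j × j ≤ m × s ≡ 2 * j)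

module Submission where

-- Let A ⊆ Z₂^(d-1) have no zero-sum subset of size
-- 2, 4, …, 2m, and let  double A = {0}×A ∪ {1}×A ⊆ Z₂^d  (2|A| vectors).
-- Split a zero-sum subset B ⊆ double A with |B| = 2t, t odd, by the leading
-- coordinate into {0}×C₀ ∪ {1}×C₁: then |C₁| is even and C₀, C₁ ⊆ A have
-- equal sums, so their symmetric difference D ⊆ A sums to zero.  With i the
-- number of common elements, |D| = 2j where i + j = t and i + 2j ≤ |A|.
-- D = ∅ would force C₀ = C₁ and |C₁| = t odd; so j ≥ 1, and A is contradicted
-- whenever j ≤ m ("collapse", then "double-admissible").  For t = m this holds
-- since j ≤ i + j = m, giving β_{2m}(d) ≥ 2β(d-1).  For t = b - m, doubling
-- the first b elements of A, i + j = b - m and i + 2j ≤ b give j ≤ m, whence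
-- β_{2b-2m}(d) ≥ 2b.

open import Defs
open import Data.Nat using (ℕ; zero; suc; _+_; _*_; _∸_; _≤_; _<_; z≤n; s≤s)
open import Data.Nat.Properties
open import Data.Product using (_×_; _,_; ∃-syntax; proj₁; proj₂)
open import Data.Bool using (Bool; true; false; not; _xor_)
open import Data.Bool.Properties
  using (xor-assoc; xor-comm; xor-same; xor-identityˡ; not-distribˡ-xor)
open import Data.Vec using ([]; _∷_)
open import Data.Vec.Properties using (∷-injective; zipWith-assoc; zipWith-comm; zipWith-identityˡ)
open import Data.List using (List; []; _∷_; length; map; _++_; take)
open import Data.List.Properties using (length-++; length-map; length-take)
open import Data.List.Membership.Propositional using (_∈_)
open import Data.List.Membership.Propositional.Properties using (∈-map⁻)
open import Data.List.Relation.Unary.Unique.Propositional using (Unique)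
import Data.List.Relation.Unary.Unique.Propositional.Properties as Unique
open import Data.List.Relation.Binary.Sublist.Propositional using (_⊆_; []; _∷ʳ_; _∷_; ⊆-trans)
open import Data.List.Relation.Binary.Sublist.Propositional.Properties using (take-⊆)
open import Relation.Binary.PropositionalEquality
open import Relation.Nullary using (¬_)

⊕-assoc : ∀ {d} (x y z : Z2^ d) → (x ⊕ y) ⊕ z ≡ x ⊕ (y ⊕ z)
⊕-assoc = zipWith-assoc xor-assoc

⊕-comm : ∀ {d} (x y : Z2^ d) → x ⊕ y ≡ y ⊕ x
⊕-comm = zipWith-comm xor-comm

⊕-identityˡ : ∀ {d} (x : Z2^ d) → zeroV ⊕ x ≡ x
⊕-identityˡ = zipWith-identityˡ xor-identityˡ

⊕-self : ∀ {d} (x : Z2^ d) → x ⊕ x ≡ zeroV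
⊕-self [] = refl
⊕-self (a ∷ x) = cong₂ _∷_ (xor-same a) (⊕-self x)

⊕-left-comm : ∀ {d} (x y z : Z2^ d) → x ⊕ (y ⊕ z) ≡ y ⊕ (x ⊕ z)
⊕-left-comm x y z = begin
  x ⊕ (y ⊕ z)   ≡⟨ sym (⊕-assoc x y z) ⟩
  (x ⊕ y) ⊕ z   ≡⟨ cong (_⊕ z) (⊕-comm x y) ⟩
  (y ⊕ x) ⊕ z   ≡⟨ ⊕-assoc y x z ⟩
  y ⊕ (x ⊕ z)   ∎
  where open ≡-Reasoning

⊕-cancel-common : ∀ {d} (x a b : Z2^ d) → (x ⊕ a) ⊕ (x ⊕ b) ≡ a ⊕ b
⊕-cancel-common x a b = begin
  (x ⊕ a) ⊕ (x ⊕ b)   ≡⟨ ⊕-assoc x a (x ⊕ b) ⟩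
  x ⊕ (a ⊕ (x ⊕ b))   ≡⟨ cong (x ⊕_) (⊕-left-comm a x b) ⟩
  x ⊕ (x ⊕ (a ⊕ b))   ≡⟨ sym (⊕-assoc x x (a ⊕ b)) ⟩
  (x ⊕ x) ⊕ (a ⊕ b)   ≡⟨ cong (_⊕ (a ⊕ b)) (⊕-self x) ⟩
  zeroV ⊕ (a ⊕ b)     ≡⟨ ⊕-identityˡ (a ⊕ b) ⟩
  a ⊕ b               ∎
  where open ≡-Reasoning

vsum-++ : ∀ {d} (xs ys : List (Z2^ d)) → vsum (xs ++ ys) ≡ vsum xs ⊕ vsum ys
vsum-++ [] ys = sym (⊕-identityˡ (vsum ys))
vsum-++ (x ∷ xs) ys = trans (cong (x ⊕_) (vsum-++ xs ys)) (sym (⊕-assoc x (vsum xs) (vsum ys)))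

-- Parity of a natural number (true = odd); it is the first coordinate of a
-- sum of vectors whose first coordinates all equal 1.
parity : ℕ → Bool
parity zero = false
parity (suc n) = not (parity n)

parity-+ : ∀ m n → parity (m + n) ≡ parity m xor parity n
parity-+ zero n = refl
parity-+ (suc m) n = trans (cong not (parity-+ m n)) (not-distribˡ-xor (parity m) (parity n))

parity-2* : ∀ k → parity (2 * k) ≡ false
parity-2* k = begin
  parity (k + (k + 0))          ≡⟨ cong (λ n → parity (k + n)) (+-identityʳ k) ⟩
  parity (k + k)                ≡⟨ parity-+ k k ⟩
  parity k xor parity k         ≡⟨ xor-same (parity k) ⟩
  false                         ∎
  where open ≡-Reasoning

parity-even : ∀ {n} → Even n → parity n ≡ false
parity-even (k , refl) = parity-2* k

parity-odd : ∀ {n} → Odd n → parity n ≡ true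
parity-odd (k , refl) = cong not (parity-2* k)

parity-even∸odd : ∀ {b m} → m ≤ b → Even b → Odd m → parity (b ∸ m) ≡ true
parity-even∸odd {b} {m} m≤b even-b odd-m = xor-true (begin
  parity (b ∸ m) xor true       ≡⟨ cong (parity (b ∸ m) xor_) (sym (parity-odd odd-m)) ⟩
  parity (b ∸ m) xor parity m   ≡⟨ sym (parity-+ (b ∸ m) m) ⟩
  parity (b ∸ m + m)            ≡⟨ cong parity (m∸n+n≡m m≤b) ⟩
  parity b                      ≡⟨ parity-even even-b ⟩
  false                         ∎)
  where
  open ≡-Reasoning
  xor-true : ∀ {x} → x xor true ≡ false → x ≡ true
  xor-true {true} _ = refl
  xor-true {false} ()

lift : ∀ {d} → List (Z2^ d) → List (Z2^ d) → List (Z2^ (suc d))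
lift C₀ C₁ = map (false ∷_) C₀ ++ map (true ∷_) C₁

double : ∀ {d} → List (Z2^ d) → List (Z2^ (suc d))
double A = lift A A

length-lift : ∀ {d} (C₀ C₁ : List (Z2^ d)) → length (lift C₀ C₁) ≡ length C₀ + length C₁
length-lift C₀ C₁ = trans (length-++ (map (false ∷_) C₀))
  (cong₂ _+_ (length-map (false ∷_) C₀) (length-map (true ∷_) C₁))

vsum-lift : ∀ {d} (C₀ C₁ : List (Z2^ d)) →
  vsum (lift C₀ C₁) ≡ parity (length C₁) ∷ (vsum C₀ ⊕ vsum C₁)
vsum-lift C₀ C₁ = trans (vsum-++ (map (false ∷_) C₀) (map (true ∷_) C₁))
                        (cong₂ _⊕_ (vsum-map₀ C₀) (vsum-map₁ C₁))
  where
  vsum-map₀ : ∀ {d} (C : List (Z2^ d)) → vsum (map (false ∷_) C) ≡ false ∷ vsum C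
  vsum-map₀ [] = refl
  vsum-map₀ (x ∷ C) = cong ((false ∷ x) ⊕_) (vsum-map₀ C)
  vsum-map₁ : ∀ {d} (C : List (Z2^ d)) → vsum (map (true ∷_) C) ≡ parity (length C) ∷ vsum C
  vsum-map₁ [] = refl
  vsum-map₁ (x ∷ C) = cong ((true ∷ x) ⊕_) (vsum-map₁ C)

length-double : ∀ {d} (A : List (Z2^ d)) → length (double A) ≡ 2 * length A
length-double A = trans (length-lift A A) (cong (length A +_) (sym (+-identityʳ (length A))))

unique-double : ∀ {d} {A : List (Z2^ d)} → Unique A → Unique (double A)
unique-double u = Unique.++⁺ (Unique.map⁺ tail-injective u) (Unique.map⁺ tail-injective u) disjoint
  where
  tail-injective : ∀ {d b} {x y : Z2^ d} → b ∷ x ≡ b ∷ y → x ≡ y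
  tail-injective e = proj₂ (∷-injective e)
  disjoint : ∀ {d} {A : List (Z2^ d)} {v} → ¬ (v ∈ map (false ∷_) A × v ∈ map (true ∷_) A)
  disjoint (v∈₀ , v∈₁) with ∈-map⁻ (false ∷_) v∈₀ | ∈-map⁻ (true ∷_) v∈₁
  ... | _ , _ , refl | _ , _ , ()

⊆-++-split : ∀ {a} {X : Set a} (xs ys : List X) {B : List X} → B ⊆ xs ++ ys →
  ∃[ B₀ ] ∃[ B₁ ] (B₀ ⊆ xs × B₁ ⊆ ys × B ≡ B₀ ++ B₁)
⊆-++-split [] ys B⊆ = [] , _ , [] , B⊆ , refl
⊆-++-split (x ∷ xs) ys (.x ∷ʳ B⊆) with ⊆-++-split xs ys B⊆
... | B₀ , B₁ , B₀⊆ , B₁⊆ , refl = B₀ , B₁ , x ∷ʳ B₀⊆ , B₁⊆ , refl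
⊆-++-split (x ∷ xs) ys (refl ∷ B⊆) with ⊆-++-split xs ys B⊆
... | B₀ , B₁ , B₀⊆ , B₁⊆ , refl = x ∷ B₀ , B₁ , refl ∷ B₀⊆ , B₁⊆ , refl

⊆-map-preimage : ∀ {a b} {X : Set a} {Y : Set b} (f : X → Y) (xs : List X) {B : List Y} →
  B ⊆ map f xs → ∃[ C ] (C ⊆ xs × B ≡ map f C)
⊆-map-preimage f [] [] = [] , [] , refl
⊆-map-preimage f (x ∷ xs) (.(f x) ∷ʳ B⊆) with ⊆-map-preimage f xs B⊆
... | C , C⊆ , refl = C , x ∷ʳ C⊆ , refl
⊆-map-preimage f (x ∷ xs) (refl ∷ B⊆) with ⊆-map-preimage f xs B⊆
... | C , C⊆ , refl = x ∷ C , refl ∷ C⊆ , refl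

⊆-double : ∀ {d} (A : List (Z2^ d)) {B : List (Z2^ (suc d))} → B ⊆ double A →
  ∃[ C₀ ] ∃[ C₁ ] (C₀ ⊆ A × C₁ ⊆ A × B ≡ lift C₀ C₁)
⊆-double A B⊆ with ⊆-++-split (map (false ∷_) A) (map (true ∷_) A) B⊆
... | B₀ , B₁ , B₀⊆ , B₁⊆ , refl
  with ⊆-map-preimage (false ∷_) A B₀⊆ | ⊆-map-preimage (true ∷_) A B₁⊆
... | C₀ , C₀⊆ , refl | C₁ , C₁⊆ , refl = C₀ , C₁ , C₀⊆ , C₁⊆ , refl

-- The symmetric difference D of two sublists C₀, C₁ of A, where `shared`
-- counts their common elements.
record SymDiff {d} (A C₀ C₁ : List (Z2^ d)) : Set where
  field
    D           : List (Z2^ d)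
    D⊆A         : D ⊆ A
    shared      : ℕ
    sizes       : length C₀ + length C₁ ≡ 2 * shared + length D
    fits        : shared + length D ≤ length A
    sum         : vsum D ≡ vsum C₀ ⊕ vsum C₁
    empty⇒equal : D ≡ [] → C₀ ≡ C₁

symDiff : ∀ {d} {A C₀ C₁ : List (Z2^ d)} → C₀ ⊆ A → C₁ ⊆ A → SymDiff A C₀ C₁
symDiff [] [] = record
  { D = [] ; D⊆A = [] ; shared = 0 ; sizes = refl ; fits = z≤n
  ; sum = sym (⊕-self zeroV) ; empty⇒equal = λ _ → refl }
symDiff (x ∷ʳ C₀⊆) (.x ∷ʳ C₁⊆) = record
  { D = D ; D⊆A = x ∷ʳ D⊆A ; shared = shared ; sizes = sizes
  ; fits = m≤n⇒m≤1+n fits ; sum = sum ; empty⇒equal = empty⇒equal }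
  where open SymDiff (symDiff C₀⊆ C₁⊆)
symDiff {C₀ = x ∷ C₀} {x ∷ C₁} (refl ∷ C₀⊆) (refl ∷ C₁⊆) = record
  { D = D ; D⊆A = x ∷ʳ D⊆A ; shared = suc shared
  ; sizes = cong suc (trans (+-suc (length C₀) (length C₁))
                     (trans (cong suc sizes) (cong (_+ length D) (sym (+-suc shared (shared + 0))))))
  ; fits = s≤s fits
  ; sum = trans sum (sym (⊕-cancel-common x (vsum C₀) (vsum C₁)))
  ; empty⇒equal = λ D≡[] → cong (x ∷_) (empty⇒equal D≡[]) }
  where open SymDiff (symDiff C₀⊆ C₁⊆)
symDiff {C₀ = x ∷ C₀} {C₁} (refl ∷ C₀⊆) (.x ∷ʳ C₁⊆) = record
  { D = x ∷ D ; D⊆A = refl ∷ D⊆A ; shared = shared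
  ; sizes = trans (cong suc sizes) (sym (+-suc (2 * shared) (length D)))
  ; fits = ≤-trans (≤-reflexive (+-suc shared (length D))) (s≤s fits)
  ; sum = trans (cong (x ⊕_) sum) (sym (⊕-assoc x (vsum C₀) (vsum C₁)))
  ; empty⇒equal = λ () }
  where open SymDiff (symDiff C₀⊆ C₁⊆)
symDiff {C₀ = C₀} {x ∷ C₁} (.x ∷ʳ C₀⊆) (refl ∷ C₁⊆) = record
  { D = x ∷ D ; D⊆A = refl ∷ D⊆A ; shared = shared
  ; sizes = trans (+-suc (length C₀) (length C₁))
                  (trans (cong suc sizes) (sym (+-suc (2 * shared) (length D))))
  ; fits = ≤-trans (≤-reflexive (+-suc shared (length D))) (s≤s fits)
  ; sum = trans (cong (x ⊕_) sum) (⊕-left-comm x (vsum C₀) (vsum C₁))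
  ; empty⇒equal = λ () }
  where open SymDiff (symDiff C₀⊆ C₁⊆)

halve : ∀ i s t → 2 * i + s ≡ 2 * t → ∃[ j ] (s ≡ 2 * j × i + j ≡ t)
halve i s t e = t ∸ i , s≡2[t∸i] , m+[n∸m]≡n i≤t
  where
  open ≡-Reasoning
  i≤t : i ≤ t
  i≤t = *-cancelˡ-≤ 2 (subst (2 * i ≤_) e (m≤m+n (2 * i) s))
  s≡2[t∸i] : s ≡ 2 * (t ∸ i)
  s≡2[t∸i] = begin
    s                   ≡⟨ sym (m+n∸m≡n (2 * i) s) ⟩
    2 * i + s ∸ 2 * i   ≡⟨ cong (_∸ 2 * i) e ⟩
    2 * t ∸ 2 * i       ≡⟨ sym (*-distribˡ-∸ 2 t i) ⟩
    2 * (t ∸ i)         ∎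

record Collapse {d} (A : List (Z2^ d)) (t : ℕ) : Set where
  field
    D        : List (Z2^ d)
    D⊆A      : D ⊆ A
    zero-sum : vsum D ≡ zeroV
    i j      : ℕ
    1≤j      : 1 ≤ j
    size     : length D ≡ 2 * j
    total    : i + j ≡ t
    fits     : i + 2 * j ≤ length A

-- Two subsets C₀, C₁ ⊆ A with |C₀| + |C₁| = 2t, t odd, |C₁| even and equal
-- sums collapse to their symmetric difference.  It cannot be empty: then
-- C₀ = C₁, so |C₁| = t would be odd.
collapse-pair : ∀ {d t} {A C₀ C₁ : List (Z2^ d)} → C₀ ⊆ A → C₁ ⊆ A →
  length C₀ + length C₁ ≡ 2 * t → parity t ≡ true → parity (length C₁) ≡ false →
  vsum C₀ ⊕ vsum C₁ ≡ zeroV → Collapse A t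
collapse-pair {t = t} {A} {C₀} {C₁} C₀⊆ C₁⊆ lengths odd-t even-C₁ sums-agree =
  fromHalves (halve shared (length D) t (trans (sym sizes) lengths))
  where
  open SymDiff (symDiff C₀⊆ C₁⊆)
  length≡0 : ∀ {X : Set} (xs : List X) → length xs ≡ 0 → xs ≡ []
  length≡0 [] _ = refl
  C₁≡t : D ≡ [] → length C₁ ≡ t
  C₁≡t D≡[] = *-cancelˡ-≡ (length C₁) t 2
    (trans (cong (λ C → length C + (length C₁ + 0)) (sym (empty⇒equal D≡[])))
           (trans (cong (length C₀ +_) (+-identityʳ (length C₁))) lengths))
  fromHalves : ∃[ j ] (length D ≡ 2 * j × shared + j ≡ t) → Collapse A t
  fromHalves (zero , size , _)
    with () ← trans (sym odd-t) (trans (cong parity (sym (C₁≡t (length≡0 D size)))) even-C₁)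
  fromHalves (suc j , size , total) = record
    { D = D ; D⊆A = D⊆A ; zero-sum = trans sum sums-agree ; i = shared ; j = suc j
    ; 1≤j = s≤s z≤n ; size = size ; total = total
    ; fits = subst (λ n → shared + n ≤ length A) size fits }

collapse : ∀ {d t} (A : List (Z2^ d)) {B : List (Z2^ (suc d))} → parity t ≡ true →
  B ⊆ double A → length B ≡ 2 * t → vsum B ≡ zeroV → Collapse A t
collapse A odd-t B⊆ |B| ΣB≡0 with ⊆-double A B⊆
... | C₀ , C₁ , C₀⊆ , C₁⊆ , refl =
  collapse-pair C₀⊆ C₁⊆ (trans (sym (length-lift C₀ C₁)) |B|) odd-t
    (proj₁ (∷-injective lifted-sum)) (proj₂ (∷-injective lifted-sum))
  where
  lifted-sum : parity (length C₁) ∷ (vsum C₀ ⊕ vsum C₁) ≡ zeroV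
  lifted-sum = trans (sym (vsum-lift C₀ C₁)) ΣB≡0

double-admissible : ∀ {d} m t (A : List (Z2^ d)) → Admissible (EvensUpTo m) d A →
  parity t ≡ true → (∀ i j → i + j ≡ t → i + 2 * j ≤ length A → j ≤ m) →
  Admissible (Single t) (suc d) (double A)
double-admissible m t A (unique-A , free-A) odd-t collapses-small =
  unique-double unique-A , double-free
  where
  double-free : WFree (Single t) (double A)
  double-free B B⊆ |B| ΣB≡0 = free-A D D⊆A (j , 1≤j , collapses-small i j total fits , size) zero-sum
    where open Collapse (collapse {t = t} A odd-t B⊆ |B| ΣB≡0)

doubling-bound : ∀ {d} m t (A : List (Z2^ d)) → Admissible (EvensUpTo m) d A →
  parity t ≡ true → (∀ i j → i + j ≡ t → i + 2 * j ≤ length A → j ≤ m) →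
  ∀ k → IsBeta (Single t) (suc d) k → 2 * length A ≤ k
doubling-bound m t A admissible-A odd-t collapses-small k (_ , maximal) =
  subst (_≤ k) (length-double A) (maximal (double A) (double-admissible m t A admissible-A odd-t collapses-small))

admissible-take : ∀ {W d} b {A : List (Z2^ d)} → Admissible W d A → Admissible W d (take b A)
admissible-take b {A} (unique-A , free-A) =
  Unique.take⁺ b unique-A , λ B B⊆ → free-A B (⊆-trans B⊆ (take-⊆ b A))

collapse-bound : ∀ {i j b m} → m ≤ b → i + j ≡ b ∸ m → i + 2 * j ≤ b → j ≤ m
collapse-bound {i} {j} {b} {m} m≤b i+j≡b∸m i+2j≤b = +-cancelˡ-≤ (b ∸ m) j m (begin
  (b ∸ m) + j     ≡⟨ cong (_+ j) (sym i+j≡b∸m) ⟩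
  (i + j) + j     ≡⟨ +-assoc i j j ⟩
  i + (j + j)     ≡⟨ cong (λ n → i + (j + n)) (sym (+-identityʳ j)) ⟩
  i + 2 * j       ≤⟨ i+2j≤b ⟩
  b               ≡⟨ sym (m+[n∸m]≡n m≤b) ⟩
  m + (b ∸ m)     ≡⟨ +-comm m (b ∸ m) ⟩
  (b ∸ m) + m     ∎)
  where open ≤-Reasoning

theorem5 : (m : ℕ) → Odd m → (d : ℕ) → 2 ≤ d →
    (n : ℕ) → IsBeta (EvensUpTo m) (d ∸ 1) n →
      ((k : ℕ) → IsBeta (Single m) d k → 2 * n ≤ k)
      × ((b : ℕ) → Even b → m < b → b ≤ n →
          (k : ℕ) → IsBeta (Single (b ∸ m)) d k → 2 * b ≤ k)
theorem5 m odd-m (suc d) _ n ((A , admissible-A , |A|≡n) , _) = bound-2m , bound-2b-2m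
  where
  -- β_{2m}(d+1) ≥ 2|A|: every collapse has j ≤ i + j = m.
  bound-2m : (k : ℕ) → IsBeta (Single m) (suc d) k → 2 * n ≤ k
  bound-2m k β = subst (λ s → 2 * s ≤ k) |A|≡n
    (doubling-bound m m A admissible-A (parity-odd odd-m) (λ i j i+j≡m _ → subst (j ≤_) i+j≡m (m≤n+m j i)) k β)
  -- β_{2b-2m}(d+1) ≥ 2b: double the first b elements of A.
  bound-2b-2m : (b : ℕ) → Even b → m < b → b ≤ n →
    (k : ℕ) → IsBeta (Single (b ∸ m)) (suc d) k → 2 * b ≤ k
  bound-2b-2m b even-b m<b b≤n k β = subst (λ s → 2 * s ≤ k) |A'|≡b
    (doubling-bound m (b ∸ m) (take b A) (admissible-take {EvensUpTo m} b admissible-A)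
      (parity-even∸odd (<⇒≤ m<b) even-b odd-m)
      (λ i j i+j≡b∸m fits → collapse-bound (<⇒≤ m<b) i+j≡b∸m (subst (i + 2 * j ≤_) |A'|≡b fits)) k β)
    where
    |A'|≡b : length (take b A) ≡ b
    |A'|≡b = trans (length-take b A) (m≤n⇒m⊓n≡m (subst (b ≤_) (sym |A|≡n) b≤n))
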